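{- Let $G$ be a finite connected simple graph on $[d]$. If the edge polytope $\mathcal{P}_G$ is decomposable, then $G$ contains at least one cycle of length $4$.
   Context: For an edge $e=(i,j)$, $\rho(e)=\mathbf{e}_i+\mathbf{e}_j\in\mathbb{R}^d$; the edge polytope $\mathcal{P}_G$ is the convex hull of $\{\rho(e):e\in E(G)\}$. A polytope $P$ is decomposable if there is a hyperplane $\mathcal{H}$ meeting the relative interior of $P$ (and not containing $P$) such that $P\cap\mathcal{H}^{(+)}$ and $P\cap\mathcal{H}^{(-)}$ are both integral polytopes, where $\mathcal{H}^{(+)},\mathcal{H}^{(-)}$ are the two closed half-spaces with intersection $\mathcal{H}$.
   Formalization: Points of the edge polytope $\mathcal{P}_G$ are taken in ℚ^d instead of ℝ^d, and the hyperplane $\mathcal{H}$ in the definition of decomposability has rational coefficients. -}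

module Defs where

open import Level using (0ℓ)
open import Data.Nat using (ℕ; zero; suc)
open import Data.Integer using (ℤ)
open import Data.Fin using (Fin; zero; suc; _≟_)
open import Data.Rational using (ℚ; 0ℚ; 1ℚ; _+_; _*_; _-_; _≤_; _<_; ∣_∣; _/_)
open import Data.List using (List; []; _∷_; map; foldr)
open import Data.List.Relation.Unary.All using (All)
open import Data.Product using (Σ; ∃; _×_; _,_; proj₁; proj₂)
open import Relation.Nullary using (¬_; yes; no)
open import Relation.Binary.PropositionalEquality using (_≡_; _≢_)
open import Relation.Binary.Construct.Closure.ReflexiveTransitive using (Star)
open import Function.Bundles using (_⇔_)

record SimpleGraph (d : ℕ) : Set₁ where
  field
    Adj     : Fin d → Fin d → Set
    symm    : ∀ {i j} → Adj i j → Adj j i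
    irrefl  : ∀ {i} → ¬ Adj i i

open SimpleGraph public

Connected : ∀ {d} → SimpleGraph d → Set
Connected {d} G = ∀ (i j : Fin d) → Star (Adj G) i j

HasCycle4 : ∀ {d} → SimpleGraph d → Set
HasCycle4 {d} G = Σ (Fin d) λ a → Σ (Fin d) λ b → Σ (Fin d) λ c → Σ (Fin d) λ e →
  (a ≢ b) × (a ≢ c) × (a ≢ e) × (b ≢ c) × (b ≢ e) × (c ≢ e) ×
  Adj G a b × Adj G b c × Adj G c e × Adj G e a

Point : ℕ → Set
Point d = Fin d → ℚ

PSet : ℕ → Set₁
PSet d = Point d → Set

sumFin : ∀ {d} → (Fin d → ℚ) → ℚ
sumFin {zero}  f = 0ℚ
sumFin {suc d} f = f zero + sumFin (λ i → f (suc i))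

_·_ : ∀ {d} → Point d → Point d → ℚ
a · x = sumFin (λ i → a i * x i)

unit : ∀ {d} → Fin d → Point d
unit i k with k ≟ i
... | yes _ = 1ℚ
... | no  _ = 0ℚ

ρ : ∀ {d} → Fin d → Fin d → Point d
ρ i j k = unit i k + unit j k

weightSum : ∀ {d} → List (ℚ × Point d) → ℚ
weightSum = foldr (λ wp s → proj₁ wp + s) 0ℚ

combo : ∀ {d} → List (ℚ × Point d) → Point d
combo L k = foldr (λ wp s → proj₁ wp * proj₂ wp k + s) 0ℚ L

ConvHull : ∀ {d} → PSet d → PSet d
ConvHull A x = Σ (List (ℚ × _)) λ L →
  All (λ wp → (0ℚ ≤ proj₁ wp) × A (proj₂ wp)) L ×
  (weightSum L ≡ 1ℚ) × (∀ k → x k ≡ combo L k)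

AffHull : ∀ {d} → PSet d → PSet d
AffHull A x = Σ (List (ℚ × _)) λ L →
  All (λ wp → A (proj₂ wp)) L ×
  (weightSum L ≡ 1ℚ) × (∀ k → x k ≡ combo L k)

RelInt : ∀ {d} → PSet d → PSet d
RelInt P x = P x × Σ ℚ λ ε → (0ℚ < ε) ×
  (∀ y → AffHull P y → (∀ k → ∣ y k - x k ∣ < ε) → P y)

EdgePolytope : ∀ {d} → SimpleGraph d → PSet d
EdgePolytope G = ConvHull (λ x → Σ _ λ i → Σ _ λ j → Adj G i j × (x ≡ ρ i j))

IntegerPoint : ∀ {d} → PSet d
IntegerPoint x = ∀ k → Σ ℤ λ z → x k ≡ z / 1

IntegralPolytope : ∀ {d} → PSet d → Set
IntegralPolytope {d} Q = Σ (List (Point d)) λ V →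
  All IntegerPoint V ×
  (∀ x → Q x ⇔ ConvHull (λ y → Data.List.Membership.Propositional._∈_ y V) x)
  where import Data.List.Membership.Propositional

Decomposable : ∀ {d} → PSet d → Set
Decomposable {d} P = Σ (Point d) λ a → Σ ℚ λ b →
  (Σ (Fin d) λ k → a k ≢ 0ℚ) ×
  (Σ (Point d) λ x → RelInt P x × (a · x ≡ b)) ×
  (Σ (Point d) λ x → P x × (a · x ≢ b)) ×
  IntegralPolytope (λ x → P x × (b ≤ a · x)) ×
  IntegralPolytope (λ x → P x × (a · x ≤ b))

{-# OPTIONS --safe #-}
module Submission where

-- Let H = {a · x = b} cut P_G so that P_G ∩ H⁺ is the convex hull of a list V of
-- integer points. As H meets the relative interior of P_G without containing it, some
-- edge ij has ρ(ij) strictly above H and some edge kl has ρ(kl) strictly below.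
-- Suppose a linear functional w is maximised over the edges representing V exactly at
-- ij and kl, i.e. the segment [ρ(ij), ρ(kl)] is exposed. Its crossing point y with H
-- lies in P_G ∩ H⁺ = conv V, and every vertex v of V with positive weight in y must
-- maximise w and lie on H, hence lie on the segment at y. At an endpoint r of ij
-- outside kl the coordinate y_r is strictly between 0 and 1, so v is not integral.
-- Such a w exists unless ij and kl are disjoint and two opposite cross pairs (ik and
-- jl, or il and jk) are edges, which is a 4-cycle: take weights 2, 1, 1 when the edges
-- share a vertex, and otherwise 5, 3 on one edge and 4, 4 on the other, the weight-5
-- vertex being one missing both cross pairs at it.

open import Defs
open import Data.Nat using (ℕ; zero; suc)
open import Data.Nat.Divisibility using (∣1⇒≡1)
import Data.Nat.Properties as ℕ
open import Data.Integer using (ℤ; -[1+_]; +<+)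
import Data.Integer as ℤ
import Data.Integer.Properties as ℤₚ
open import Data.Fin using (Fin; zero; suc; _≟_)
open import Data.Rational
  using (ℚ; 0ℚ; 1ℚ; _+_; _*_; _-_; -_; 1/_; _/_; ∣_∣; _≤_; _<_; NonZero; positive; nonNegative)
open import Data.Rational.Properties
  hiding (_≟_)
open import Data.Rational.Solver using (module +-*-Solver)
open import Data.List using (List; []; _∷_; _++_; foldr)
open import Data.List.Relation.Unary.All as All using (All; []; _∷_)
open import Data.List.Relation.Unary.All.Properties using (¬Any⇒All¬)
open import Data.List.Relation.Unary.Any using (Any; here; there; any?)
open import Data.List.Membership.Propositional using (_∈_; lose)
open import Data.List.Membership.Propositional.Properties using (∈-++⁺ˡ; ∈-++⁺ʳ)
open import Data.Product using (Σ; _×_; _,_; proj₁; proj₂)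
open import Data.Sum using (_⊎_; inj₁; inj₂; [_,_])
open import Data.Empty using (⊥; ⊥-elim)
open import Relation.Nullary using (¬_; Dec; yes; no)
open import Relation.Nullary.Decidable using (True; toWitness; _×-dec_; _⊎-dec_)
open import Relation.Binary.PropositionalEquality
  using (_≡_; _≢_; _≗_; refl; sym; trans; cong; cong₂; subst; subst₂; ≢-sym; module ≡-Reasoning)
open import Relation.Binary.Definitions using (tri<; tri≈; tri>)
open import Function.Base using (id)
open import Function.Bundles using (_⇔_; Equivalence)

open +-*-Solver

decide-< : ∀ {p q} {p<q : True (p <? q)} → p < q
decide-< {p<q = p<q} = toWitness p<q

0<1 : 0ℚ < 1ℚ
0<1 = decide-<

<⇒≱ : ∀ {p q} → p < q → ¬ q ≤ p
<⇒≱ p<q q≤p = <-irrefl refl (<-≤-trans p<q q≤p)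

p≤q⇒0≤q-p : ∀ {p q} → p ≤ q → 0ℚ ≤ q - p
p≤q⇒0≤q-p {p} {q} p≤q = subst (_≤ q - p) (+-inverseʳ p) (+-monoˡ-≤ (- p) p≤q)

p<q⇒0<q-p : ∀ {p q} → p < q → 0ℚ < q - p
p<q⇒0<q-p {p} {q} p<q = subst (_< q - p) (+-inverseʳ p) (+-monoˡ-< (- p) p<q)

q-p≡0⇒p≡q : ∀ {p q} → q - p ≡ 0ℚ → p ≡ q
q-p≡0⇒p≡q {p} {q} e = begin
  p             ≡⟨ solve 2 (λ p q → p := q :- (q :- p)) refl p q ⟩
  q - (q - p)   ≡⟨ cong (λ t → q - t) e ⟩
  q - 0ℚ        ≡⟨ solve 1 (λ q → q :- con 0ℚ := q) refl q ⟩
  q             ∎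
  where open ≡-Reasoning

nonNeg+nonNeg≡0⇒≡0ˡ : ∀ {p q} → 0ℚ ≤ p → 0ℚ ≤ q → p + q ≡ 0ℚ → p ≡ 0ℚ
nonNeg+nonNeg≡0⇒≡0ˡ {p} 0≤p 0≤q e =
  ≤-antisym (subst₂ _≤_ (+-identityʳ p) e (+-monoʳ-≤ p 0≤q)) 0≤p

nonNeg+nonNeg≡0⇒≡0ʳ : ∀ {p q} → 0ℚ ≤ p → 0ℚ ≤ q → p + q ≡ 0ℚ → q ≡ 0ℚ
nonNeg+nonNeg≡0⇒≡0ʳ {p} {q} 0≤p 0≤q e = nonNeg+nonNeg≡0⇒≡0ˡ 0≤q 0≤p (trans (+-comm q p) e)

0≤*0≤ : ∀ {p q} → 0ℚ ≤ p → 0ℚ ≤ q → 0ℚ ≤ p * q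
0≤*0≤ {p} {q} 0≤p 0≤q = subst (_≤ p * q) (*-zeroʳ p) (*-monoˡ-≤-nonNeg p {{nonNegative 0≤p}} 0≤q)

0<*0< : ∀ {p q} → 0ℚ < p → 0ℚ < q → 0ℚ < p * q
0<*0< {p} {q} 0<p 0<q = subst (_< p * q) (*-zeroʳ p) (*-monoʳ-<-pos p {{positive 0<p}} 0<q)

p<p+pos : ∀ {p t} → 0ℚ < t → p < p + t
p<p+pos {p} {t} 0<t = subst (_< p + t) (+-identityʳ p) (+-monoʳ-< p 0<t)

p+neg<p : ∀ {p t} → t < 0ℚ → p + t < p
p+neg<p {p} {t} t<0 = subst (p + t <_) (+-identityʳ p) (+-monoʳ-< p t<0)

*-cancelˡ-≡-pos : ∀ {r p q} → 0ℚ < r → r * p ≡ r * q → p ≡ q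
*-cancelˡ-≡-pos {r} 0<r e = ≤-antisym (*-cancelˡ-≤-pos r {{positive 0<r}} (≤-reflexive e))
                                      (*-cancelˡ-≤-pos r {{positive 0<r}} (≤-reflexive (sym e)))

pos*q≡0⇒q≡0 : ∀ {p q} → 0ℚ < p → p * q ≡ 0ℚ → q ≡ 0ℚ
pos*q≡0⇒q≡0 {p} 0<p e = *-cancelˡ-≡-pos 0<p (trans e (sym (*-zeroʳ p)))

integer∉⟨0,1⟩ : ∀ (z : ℤ) → 0ℚ < z / 1 → z / 1 < 1ℚ → ⊥
integer∉⟨0,1⟩ (ℤ.+ n) 0<n n<1
  rewrite normalize-coprime {n} {0} (λ c → ∣1⇒≡1 (proj₂ c))
  with drop-*<* 0<n | drop-*<* n<1
... | p | q rewrite ℤₚ.*-identityʳ (ℤ.+ n) with p | q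
... | +<+ 0<n' | +<+ n<1' = ℕ.<-irrefl refl (ℕ.<-≤-trans 0<n' (ℕ.≤-pred n<1'))
integer∉⟨0,1⟩ -[1+ n ] 0<z _
  rewrite normalize-coprime {suc n} {0} (λ c → ∣1⇒≡1 (proj₂ c))
  with drop-*<* 0<z
... | p rewrite ℤₚ.*-identityʳ -[1+ n ] with p
... | ()

sumFin-cong : ∀ {d} {f g : Fin d → ℚ} → f ≗ g → sumFin f ≡ sumFin g
sumFin-cong {zero}  _   = refl
sumFin-cong {suc d} f≗g = cong₂ _+_ (f≗g zero) (sumFin-cong (λ i → f≗g (suc i)))

sumFin-+ : ∀ {d} (f g : Fin d → ℚ) → sumFin (λ i → f i + g i) ≡ sumFin f + sumFin g
sumFin-+ {zero}  f g = refl
sumFin-+ {suc d} f g rewrite sumFin-+ (λ i → f (suc i)) (λ i → g (suc i)) =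
  solve 4 (λ a b c e → (a :+ b) :+ (c :+ e) := (a :+ c) :+ (b :+ e)) refl
    (f zero) (g zero) (sumFin (λ i → f (suc i))) (sumFin (λ i → g (suc i)))

sumFin-* : ∀ {d} (c : ℚ) (f : Fin d → ℚ) → sumFin (λ i → c * f i) ≡ c * sumFin f
sumFin-* {zero}  c f = sym (*-zeroʳ c)
sumFin-* {suc d} c f rewrite sumFin-* c (λ i → f (suc i)) = sym (*-distribˡ-+ c (f zero) _)

sumFin-0 : ∀ {d} → sumFin {d} (λ _ → 0ℚ) ≡ 0ℚ
sumFin-0 {zero}  = refl
sumFin-0 {suc d} = trans (+-identityˡ _) (sumFin-0 {d})

sumFin-nonNeg : ∀ {d} {f : Fin d → ℚ} → (∀ i → 0ℚ ≤ f i) → 0ℚ ≤ sumFin f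
sumFin-nonNeg {zero}  _   = ≤-refl
sumFin-nonNeg {suc d} 0≤f = +-mono-≤ (0≤f zero) (sumFin-nonNeg (λ i → 0≤f (suc i)))

term≤sumFin : ∀ {d} {f : Fin d → ℚ} → (∀ i → 0ℚ ≤ f i) → ∀ k → f k ≤ sumFin f
term≤sumFin {suc d} {f} 0≤f zero =
  subst (_≤ sumFin f) (+-identityʳ (f zero)) (+-monoʳ-≤ (f zero) (sumFin-nonNeg (λ i → 0≤f (suc i))))
term≤sumFin {suc d} {f} 0≤f (suc k) =
  ≤-trans (term≤sumFin (λ i → 0≤f (suc i)) k)
    (subst (_≤ sumFin f) (+-identityˡ _) (+-monoˡ-≤ (sumFin (λ i → f (suc i))) (0≤f zero)))

·-congˡ : ∀ {d} (u : Point d) {x y : Point d} → x ≗ y → u · x ≡ u · y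
·-congˡ u x≗y = sumFin-cong (λ i → cong (u i *_) (x≗y i))

unit-self : ∀ {d} (i : Fin d) → unit i i ≡ 1ℚ
unit-self i with i ≟ i
... | yes _  = refl
... | no i≢i = ⊥-elim (i≢i refl)

unit-≢ : ∀ {d} {i k : Fin d} → k ≢ i → unit i k ≡ 0ℚ
unit-≢ {i = i} {k} k≢i with k ≟ i
... | yes k≡i = ⊥-elim (k≢i k≡i)
... | no _    = refl

sumFin-unit : ∀ {d} (i : Fin d) → sumFin (unit i) ≡ 1ℚ
sumFin-unit {suc d} zero = begin
  1ℚ + sumFin {d} (λ k → unit zero (suc k)) ≡⟨ cong (λ t → 1ℚ + t) (trans (sumFin-cong off-zero) (sumFin-0 {d})) ⟩
  1ℚ + 0ℚ                                  ≡⟨ +-identityʳ 1ℚ ⟩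
  1ℚ                                       ∎
  where
  open ≡-Reasoning
  off-zero : (λ k → unit {suc d} zero (suc k)) ≗ (λ _ → 0ℚ)
  off-zero k = unit-≢ {i = zero} {k = suc k} λ ()
sumFin-unit {suc d} (suc i) = begin
  0ℚ + sumFin (λ k → unit (suc i) (suc k)) ≡⟨ +-identityˡ _ ⟩
  sumFin (λ k → unit (suc i) (suc k))      ≡⟨ sumFin-cong unit-suc ⟩
  sumFin (unit i)                          ≡⟨ sumFin-unit i ⟩
  1ℚ                                       ∎
  where
  open ≡-Reasoning
  unit-suc : (λ k → unit (suc i) (suc k)) ≗ unit i
  unit-suc k with k ≟ i
  ... | yes _ = refl
  ... | no _  = refl

·-unit : ∀ {d} (u : Point d) (i : Fin d) → u · unit i ≡ u i
·-unit u i = begin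
  sumFin (λ k → u k * unit i k)  ≡⟨ sumFin-cong only-i ⟩
  sumFin (λ k → u i * unit i k)  ≡⟨ sumFin-* (u i) (unit i) ⟩
  u i * sumFin (unit i)          ≡⟨ cong (u i *_) (sumFin-unit i) ⟩
  u i * 1ℚ                       ≡⟨ *-identityʳ (u i) ⟩
  u i                            ∎
  where
  open ≡-Reasoning
  only-i : ∀ k → u k * unit i k ≡ u i * unit i k
  only-i k with k ≟ i
  ... | yes refl = refl
  ... | no _     = trans (*-zeroʳ (u k)) (sym (*-zeroʳ (u i)))

·-ρ : ∀ {d} (u : Point d) (i j : Fin d) → u · ρ i j ≡ u i + u j
·-ρ u i j = begin
  sumFin (λ k → u k * (unit i k + unit j k))         ≡⟨ sumFin-cong (λ k → *-distribˡ-+ (u k) _ _) ⟩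
  sumFin (λ k → u k * unit i k + u k * unit j k)     ≡⟨ sumFin-+ (λ k → u k * unit i k) (λ k → u k * unit j k) ⟩
  u · unit i + u · unit j                            ≡⟨ cong₂ _+_ (·-unit u i) (·-unit u j) ⟩
  u i + u j                                          ∎
  where open ≡-Reasoning

ρ-outside : ∀ {d} {i j r : Fin d} → r ≢ i → r ≢ j → ρ i j r ≡ 0ℚ
ρ-outside r≢i r≢j rewrite unit-≢ r≢i | unit-≢ r≢j = refl

ρ-comm : ∀ {d} (i j : Fin d) → ρ i j ≗ ρ j i
ρ-comm i j k = +-comm (unit i k) (unit j k)

weightedSum : ∀ {d} → List (ℚ × Point d) → (Point d → ℚ) → ℚ
weightedSum L f = foldr (λ wp s → proj₁ wp * f (proj₂ wp) + s) 0ℚ L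

module _ {d : ℕ} where

  weightedSum-+ : ∀ (L : List (ℚ × Point d)) f g →
    weightedSum L (λ z → f z + g z) ≡ weightedSum L f + weightedSum L g
  weightedSum-+ []            f g = refl
  weightedSum-+ ((μ , z) ∷ L) f g rewrite weightedSum-+ L f g =
    solve 5 (λ μ a b s t → μ :* (a :+ b) :+ (s :+ t) := (μ :* a :+ s) :+ (μ :* b :+ t)) refl
      μ (f z) (g z) (weightedSum L f) (weightedSum L g)

  weightedSum-difference : ∀ (L : List (ℚ × Point d)) f g →
    weightedSum L (λ z → f z - g z) ≡ weightedSum L f - weightedSum L g
  weightedSum-difference []            f g = solve 0 (con 0ℚ := con 0ℚ :- con 0ℚ) refl
  weightedSum-difference ((μ , z) ∷ L) f g rewrite weightedSum-difference L f g =
    solve 5 (λ μ a b s t → μ :* (a :- b) :+ (s :- t) := (μ :* a :+ s) :- (μ :* b :+ t)) refl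
      μ (f z) (g z) (weightedSum L f) (weightedSum L g)

  weightedSum-* : ∀ (L : List (ℚ × Point d)) c f →
    weightedSum L (λ z → c * f z) ≡ c * weightedSum L f
  weightedSum-* []            c f = sym (*-zeroʳ c)
  weightedSum-* ((μ , z) ∷ L) c f rewrite weightedSum-* L c f =
    solve 4 (λ μ c a s → μ :* (c :* a) :+ c :* s := c :* (μ :* a :+ s)) refl μ c (f z) (weightedSum L f)

  weightedSum-const : ∀ (L : List (ℚ × Point d)) c → weightedSum L (λ _ → c) ≡ c * weightSum L
  weightedSum-const []            c = sym (*-zeroʳ c)
  weightedSum-const ((μ , z) ∷ L) c rewrite weightedSum-const L c =
    solve 3 (λ μ c s → μ :* c :+ c :* s := c :* (μ :+ s)) refl μ c (weightSum L)

  ·-combo : ∀ (u : Point d) L → u · combo L ≡ weightedSum L (u ·_)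
  ·-combo u [] = trans (sumFin-cong (λ i → *-zeroʳ (u i))) (sumFin-0 {d})
  ·-combo u ((μ , z) ∷ L) = begin
    sumFin (λ i → u i * (μ * z i + combo L i))
      ≡⟨ sumFin-cong (λ i → solve 4 (λ a μ b c → a :* (μ :* b :+ c) := μ :* (a :* b) :+ a :* c) refl
                                     (u i) μ (z i) (combo L i)) ⟩
    sumFin (λ i → μ * (u i * z i) + u i * combo L i)
      ≡⟨ sumFin-+ (λ i → μ * (u i * z i)) (λ i → u i * combo L i) ⟩
    sumFin (λ i → μ * (u i * z i)) + u · combo L
      ≡⟨ cong₂ _+_ (sumFin-* μ (λ i → u i * z i)) (·-combo u L) ⟩
    μ * (u · z) + weightedSum L (u ·_) ∎
    where open ≡-Reasoning

  weightedSum-mono : ∀ {L : List (ℚ × Point d)} {f g} →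
    All (λ wp → 0ℚ ≤ proj₁ wp × f (proj₂ wp) ≤ g (proj₂ wp)) L → weightedSum L f ≤ weightedSum L g
  weightedSum-mono []                = ≤-refl
  weightedSum-mono {(μ , _) ∷ _} ((0≤μ , f≤g) ∷ h) =
    +-mono-≤ (*-monoˡ-≤-nonNeg μ {{nonNegative 0≤μ}} f≤g) (weightedSum-mono h)

  weightedSum-nonNeg : ∀ {L : List (ℚ × Point d)} {f} →
    All (λ wp → 0ℚ ≤ proj₁ wp × 0ℚ ≤ f (proj₂ wp)) L → 0ℚ ≤ weightedSum L f
  weightedSum-nonNeg []                = ≤-refl
  weightedSum-nonNeg ((0≤μ , 0≤f) ∷ h) = +-mono-≤ (0≤*0≤ 0≤μ 0≤f) (weightedSum-nonNeg h)

  weightedSum-zeros : ∀ {L : List (ℚ × Point d)} {f} →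
    All (λ wp → proj₁ wp * f (proj₂ wp) ≡ 0ℚ) L → weightedSum L f ≡ 0ℚ
  weightedSum-zeros []       = refl
  weightedSum-zeros (e ∷ es) rewrite e | weightedSum-zeros es = refl

  weightedSum≡0⇒terms≡0 : ∀ {L : List (ℚ × Point d)} {f} →
    All (λ wp → 0ℚ ≤ proj₁ wp × 0ℚ ≤ f (proj₂ wp)) L → weightedSum L f ≡ 0ℚ →
    All (λ wp → proj₁ wp * f (proj₂ wp) ≡ 0ℚ) L
  weightedSum≡0⇒terms≡0 []                 _ = []
  weightedSum≡0⇒terms≡0 ((0≤μ , 0≤f) ∷ h) e =
    nonNeg+nonNeg≡0⇒≡0ˡ 0≤term (weightedSum-nonNeg h) e ∷
    weightedSum≡0⇒terms≡0 h (nonNeg+nonNeg≡0⇒≡0ʳ 0≤term (weightedSum-nonNeg h) e)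
    where 0≤term = 0≤*0≤ 0≤μ 0≤f

  some-weight-positive : ∀ {L : List (ℚ × Point d)} →
    All (λ wp → 0ℚ ≤ proj₁ wp) L → weightSum L ≡ 1ℚ → Any (λ wp → 0ℚ < proj₁ wp) L
  some-weight-positive {[]}          [] ()
  some-weight-positive {(μ , z) ∷ L} (0≤μ ∷ h) sum≡1 with 0ℚ <? μ
  ... | yes 0<μ = here 0<μ
  ... | no  0≮μ = there (some-weight-positive h (trans (sym (+-identityˡ _)) rest≡1))
    where
    rest≡1 : 0ℚ + weightSum L ≡ 1ℚ
    rest≡1 = subst (λ t → t + weightSum L ≡ 1ℚ) (≤-antisym (≮⇒≥ 0≮μ) 0≤μ) sum≡1

  weightedSum≤ : ∀ {L : List (ℚ × Point d)} {f c} →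
    All (λ wp → 0ℚ ≤ proj₁ wp × f (proj₂ wp) ≤ c) L → weightSum L ≡ 1ℚ → weightedSum L f ≤ c
  weightedSum≤ {L} {f} {c} bound sum≡1 = begin
    weightedSum L f         ≤⟨ weightedSum-mono bound ⟩
    weightedSum L (λ _ → c) ≡⟨ weightedSum-const L c ⟩
    c * weightSum L         ≡⟨ cong (c *_) sum≡1 ⟩
    c * 1ℚ                  ≡⟨ *-identityʳ c ⟩
    c                       ∎
    where open ≤-Reasoning

  weightedSum≥ : ∀ {L : List (ℚ × Point d)} {f c} →
    All (λ wp → 0ℚ ≤ proj₁ wp × c ≤ f (proj₂ wp)) L → weightSum L ≡ 1ℚ → c ≤ weightedSum L f
  weightedSum≥ {L} {f} {c} bound sum≡1 = begin
    c                       ≡⟨ sym (*-identityʳ c) ⟩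
    c * 1ℚ                  ≡⟨ cong (c *_) (sym sum≡1) ⟩
    c * weightSum L         ≡⟨ sym (weightedSum-const L c) ⟩
    weightedSum L (λ _ → c) ≤⟨ weightedSum-mono bound ⟩
    weightedSum L f         ∎
    where open ≤-Reasoning

record IsAffine {d : ℕ} (f : Point d → ℚ) : Set where
  field
    resp-≗    : ∀ {x y} → x ≗ y → f x ≡ f y
    combo-hom : ∀ L → weightSum L ≡ 1ℚ → f (combo L) ≡ weightedSum L f

  of-combo : ∀ {x} L → x ≗ combo L → weightSum L ≡ 1ℚ → f x ≡ weightedSum L f
  of-combo L x≗L sum≡1 = trans (resp-≗ x≗L) (combo-hom L sum≡1)

open IsAffine

module _ {d : ℕ} where

  dot-affine : (u : Point d) → IsAffine (u ·_)
  dot-affine u = record { resp-≗ = ·-congˡ u ; combo-hom = λ L _ → ·-combo u L }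

  coordinate-affine : (r : Fin d) → IsAffine (λ x → x r)
  coordinate-affine r = record { resp-≗ = λ x≗y → x≗y r ; combo-hom = λ _ _ → refl }

  const-affine : (c : ℚ) → IsAffine {d} (λ _ → c)
  const-affine c = record
    { resp-≗    = λ _ → refl
    ; combo-hom = λ L sum≡1 → sym (trans (weightedSum-const L c) (trans (cong (c *_) sum≡1) (*-identityʳ c)))
    }

  sum-affine : ∀ {f g : Point d → ℚ} → IsAffine f → IsAffine g → IsAffine (λ x → f x + g x)
  sum-affine {f} {g} F G = record
    { resp-≗    = λ x≗y → cong₂ _+_ (resp-≗ F x≗y) (resp-≗ G x≗y)
    ; combo-hom = λ L sum≡1 →
        trans (cong₂ _+_ (combo-hom F L sum≡1) (combo-hom G L sum≡1)) (sym (weightedSum-+ L f g))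
    }

  difference-affine : ∀ {f g : Point d → ℚ} → IsAffine f → IsAffine g → IsAffine (λ x → f x - g x)
  difference-affine {f} {g} F G = record
    { resp-≗    = λ x≗y → cong₂ _-_ (resp-≗ F x≗y) (resp-≗ G x≗y)
    ; combo-hom = λ L sum≡1 →
        trans (cong₂ _-_ (combo-hom F L sum≡1) (combo-hom G L sum≡1)) (sym (weightedSum-difference L f g))
    }

  scale-affine : ∀ (c : ℚ) {f : Point d → ℚ} → IsAffine f → IsAffine (λ x → c * f x)
  scale-affine c {f} F = record
    { resp-≗    = λ x≗y → cong (c *_) (resp-≗ F x≗y)
    ; combo-hom = λ L sum≡1 → trans (cong (c *_) (combo-hom F L sum≡1)) (sym (weightedSum-* L c f))
    }

  lerp : ℚ → Point d → Point d → Point d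
  lerp t p q = combo ((t , p) ∷ (1ℚ - t , q) ∷ [])

  lerp-weightSum : ∀ t (p q : Point d) → weightSum ((t , p) ∷ (1ℚ - t , q) ∷ []) ≡ 1ℚ
  lerp-weightSum t _ _ = solve 1 (λ t → t :+ ((con 1ℚ :- t) :+ con 0ℚ) := con 1ℚ) refl t

  affine-lerp : ∀ {f} → IsAffine f → ∀ t (p q : Point d) → f (lerp t p q) ≡ t * f p + (1ℚ - t) * f q
  affine-lerp {f} F t p q =
    trans (combo-hom F ((t , p) ∷ (1ℚ - t , q) ∷ []) (lerp-weightSum t p q))
          (cong (λ s → t * f p + s) (+-identityʳ _))

module _ {d : ℕ} {A : PSet d} where

  ConvHull-point : ∀ {z} → A z → ConvHull A z
  ConvHull-point {z} Az = (1ℚ , z) ∷ [] , (<⇒≤ 0<1 , Az) ∷ [] , refl ,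
    λ k → solve 1 (λ x → x := con 1ℚ :* x :+ con 0ℚ) refl (z k)

  ConvHull-lerp : ∀ {t p q} → A p → A q → 0ℚ ≤ t → t ≤ 1ℚ → ConvHull A (lerp t p q)
  ConvHull-lerp {t} {p} {q} Ap Aq 0≤t t≤1 =
    _ , (0≤t , Ap) ∷ (p≤q⇒0≤q-p t≤1 , Aq) ∷ [] , lerp-weightSum t p q , λ _ → refl

  ConvHull-bounded : ∀ {f c x} → IsAffine f → (∀ {z} → A z → f z ≤ c) → ConvHull A x → f x ≤ c
  ConvHull-bounded F bound (L , members , sum≡1 , x≗L) =
    subst (_≤ _) (sym (of-combo F L x≗L sum≡1))
      (weightedSum≤ (All.map (λ (0≤μ , Az) → 0≤μ , bound Az) members) sum≡1)

  ConvHull-witness> : ∀ {f c x} → IsAffine f → ConvHull A x → c < f x → Σ (Point d) λ z → A z × c < f z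
  ConvHull-witness> {f} {c} F (L , members , sum≡1 , x≗L) c<fx
    with any? (λ wp → c <? f (proj₂ wp)) L
  ... | yes found = let ((_ , Az) , c<fz) = All.lookupAny members found in _ , Az , c<fz
  ... | no  none  = ⊥-elim (<⇒≱ c<fx (subst (_≤ c) (sym (of-combo F L x≗L sum≡1))
      (weightedSum≤ (All.zipWith (λ ((0≤μ , _) , c≮fz) → 0≤μ , ≮⇒≥ c≮fz) (members , ¬Any⇒All¬ L none))
                    sum≡1)))

  ConvHull-witness< : ∀ {f c x} → IsAffine f → ConvHull A x → f x < c → Σ (Point d) λ z → A z × f z < c
  ConvHull-witness< {f} {c} F (L , members , sum≡1 , x≗L) fx<c
    with any? (λ wp → f (proj₂ wp) <? c) L
  ... | yes found = let ((_ , Az) , fz<c) = All.lookupAny members found in _ , Az , fz<c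
  ... | no  none  = ⊥-elim (<⇒≱ fx<c (subst (c ≤_) (sym (of-combo F L x≗L sum≡1))
      (weightedSum≥ (All.zipWith (λ ((0≤μ , _) , fz≮c) → 0≤μ , ≮⇒≥ fz≮c) (members , ¬Any⇒All¬ L none))
                    sum≡1)))

  ConvHull-zero-attained : ∀ {f x} → IsAffine f → (∀ {z} → A z → 0ℚ ≤ f z) → ConvHull A x → f x ≡ 0ℚ →
    Σ (Point d) λ z → A z × f z ≡ 0ℚ
  ConvHull-zero-attained F 0≤f (L , members , sum≡1 , x≗L) fx≡0
    with All.lookupAny (All.zip (members , terms≡0)) (some-weight-positive (All.map proj₁ members) sum≡1)
    where
    terms≡0 = weightedSum≡0⇒terms≡0 (All.map (λ (0≤μ , Az) → 0≤μ , 0≤f Az) members)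
                (trans (sym (of-combo F L x≗L sum≡1)) fx≡0)
  ... | ((_ , Az) , μfz≡0) , 0<μ = _ , Az , pos*q≡0⇒q≡0 0<μ μfz≡0

  ConvHull-face : ∀ {f g x} → IsAffine f → IsAffine g → (∀ {z} → A z → 0ℚ ≤ f z) →
    (∀ {z} → A z → f z ≡ 0ℚ → g z ≡ 0ℚ) → ConvHull A x → f x ≡ 0ℚ → g x ≡ 0ℚ
  ConvHull-face {f} {g} F G 0≤f face (L , members , sum≡1 , x≗L) fx≡0 =
    trans (of-combo G L x≗L sum≡1) (weightedSum-zeros (All.zipWith term≡0 (members , terms≡0)))
    where
    terms≡0 = weightedSum≡0⇒terms≡0 (All.map (λ (0≤μ , Az) → 0≤μ , 0≤f Az) members)
                (trans (sym (of-combo F L x≗L sum≡1)) fx≡0)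
    term≡0 : ∀ {wp : ℚ × Point d} → (0ℚ ≤ proj₁ wp × A (proj₂ wp)) × proj₁ wp * f (proj₂ wp) ≡ 0ℚ →
             proj₁ wp * g (proj₂ wp) ≡ 0ℚ
    term≡0 {μ , z} ((0≤μ , Az) , μfz≡0) with 0ℚ <? μ
    ... | yes 0<μ = trans (cong (μ *_) (face Az (pos*q≡0⇒q≡0 0<μ μfz≡0))) (*-zeroʳ μ)
    ... | no  0≮μ = trans (cong (_* g z) (≤-antisym (≮⇒≥ 0≮μ) 0≤μ)) (*-zeroˡ (g z))

  ConvHull-attains-bounds : ∀ {f g M c x} → IsAffine f → IsAffine g →
    (∀ {z} → A z → f z ≤ M) → (∀ {z} → A z → c ≤ g z) → ConvHull A x → f x ≡ M → g x ≡ c →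
    Σ (Point d) λ z → A z × f z ≡ M × g z ≡ c
  ConvHull-attains-bounds {f} {g} {M} {c} F G f≤M c≤g x∈A fx≡M gx≡c =
    z , Az , q-p≡0⇒p≡q (nonNeg+nonNeg≡0⇒≡0ˡ 0≤M-fz 0≤gz-c slack≡0) ,
    sym (q-p≡0⇒p≡q (nonNeg+nonNeg≡0⇒≡0ʳ 0≤M-fz 0≤gz-c slack≡0))
    where
    tight = ConvHull-zero-attained (sum-affine (difference-affine (const-affine M) F) (difference-affine G (const-affine c)))
      (λ Az → +-mono-≤ (p≤q⇒0≤q-p (f≤M Az)) (p≤q⇒0≤q-p (c≤g Az))) x∈A
      (trans (cong₂ (λ s t → (M - s) + (t - c)) fx≡M gx≡c) (solve 2 (λ M c → (M :- M) :+ (c :- c) := con 0ℚ) refl M c))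
    z = proj₁ tight
    Az = proj₁ (proj₂ tight)
    slack≡0 = proj₂ (proj₂ tight)
    0≤M-fz = p≤q⇒0≤q-p (f≤M Az)
    0≤gz-c = p≤q⇒0≤q-p (c≤g Az)

ConvHull-mono : ∀ {d} {A B : PSet d} → (∀ {z} → A z → B z) → ∀ {x} → ConvHull A x → ConvHull B x
ConvHull-mono A⊆B (L , members , sum≡1 , x≗L) = L , All.map (λ (0≤μ , Az) → 0≤μ , A⊆B Az) members , sum≡1 , x≗L

record RelIntExtension {d} (P : PSet d) (x y : Point d) : Set where
  field
    δ      : ℚ
    0<δ    : 0ℚ < δ
    beyond : P (lerp (1ℚ + δ) x y)

RelInt-extend : ∀ {d} {P : PSet d} {x y} → RelInt P x → P y → RelIntExtension P x y
RelInt-extend {d} {P} {x} {y} (Px , ε , 0<ε , ball) Py =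
  record { δ = δ ; 0<δ = 0<δ ; beyond = ball _ on-affine-hull near-x }
  where
  distance spread δ : ℚ
  distance = sumFin (λ k → ∣ x k - y k ∣)
  spread   = 1ℚ + distance

  term≤distance : ∀ k → ∣ x k - y k ∣ ≤ distance
  term≤distance = term≤sumFin (λ k → 0≤∣p∣ (x k - y k))

  distance<spread : distance < spread
  distance<spread = subst (_< spread) (+-identityˡ distance) (+-monoˡ-< distance 0<1)

  0<spread : 0ℚ < spread
  0<spread = ≤-<-trans (sumFin-nonNeg (λ k → 0≤∣p∣ (x k - y k))) distance<spread

  instance
    spread≢0 : NonZero spread
    spread≢0 = pos⇒nonZero spread {{positive 0<spread}}

  δ = ε * 1/ spread

  0<δ : 0ℚ < δ
  0<δ = 0<*0< 0<ε (positive⁻¹ _ {{1/pos⇒pos spread {{positive 0<spread}}}})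

  δ*spread≡ε : δ * spread ≡ ε
  δ*spread≡ε = trans (*-assoc ε (1/ spread) spread) (trans (cong (ε *_) (*-inverseˡ spread)) (*-identityʳ ε))

  on-affine-hull : AffHull P (lerp (1ℚ + δ) x y)
  on-affine-hull =
    (1ℚ + δ , x) ∷ (1ℚ - (1ℚ + δ) , y) ∷ [] , Px ∷ Py ∷ [] , lerp-weightSum (1ℚ + δ) x y , λ _ → refl

  near-x : ∀ k → ∣ lerp (1ℚ + δ) x y k - x k ∣ < ε
  near-x k = begin-strict
    ∣ lerp (1ℚ + δ) x y k - x k ∣  ≡⟨ cong ∣_∣ (solve 3 (λ δ u v →
                                        (con 1ℚ :+ δ) :* u :+ ((con 1ℚ :- (con 1ℚ :+ δ)) :* v :+ con 0ℚ) :- u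
                                        := δ :* (u :- v)) refl δ (x k) (y k)) ⟩
    ∣ δ * (x k - y k) ∣            ≡⟨ ∣p*q∣≡∣p∣*∣q∣ δ _ ⟩
    ∣ δ ∣ * ∣ x k - y k ∣          ≡⟨ cong (_* ∣ x k - y k ∣) (0≤p⇒∣p∣≡p (<⇒≤ 0<δ)) ⟩
    δ * ∣ x k - y k ∣              ≤⟨ *-monoˡ-≤-nonNeg δ {{nonNegative (<⇒≤ 0<δ)}} (term≤distance k) ⟩
    δ * distance                   <⟨ *-monoʳ-<-pos δ {{positive 0<δ}} distance<spread ⟩
    δ * spread                     ≡⟨ δ*spread≡ε ⟩
    ε                              ∎
    where open ≤-Reasoning

affine-extension : ∀ {d} {f : Point d → ℚ} → IsAffine f → ∀ δ x y →
  f (lerp (1ℚ + δ) x y) ≡ f x + δ * (f x - f y)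
affine-extension {f = f} F δ x y = trans (affine-lerp F (1ℚ + δ) x y)
  (solve 3 (λ δ a c → (con 1ℚ :+ δ) :* a :+ (con 1ℚ :- (con 1ℚ :+ δ)) :* c := a :+ δ :* (a :- c)) refl δ (f x) (f y))

hyperplane-through-RelInt-splits : ∀ {d} {X : PSet d} {f b x y} → IsAffine f →
  RelInt (ConvHull X) x → f x ≡ b → ConvHull X y → f y ≢ b →
  (Σ (Point d) λ z → X z × b < f z) × (Σ (Point d) λ z → X z × f z < b)
hyperplane-through-RelInt-splits {f = f} {x = x} {y} F x∈relint refl y∈P fy≢fx with <-cmp (f y) (f x)
... | tri≈ _ fy≡fx _ = ⊥-elim (fy≢fx fy≡fx)
... | tri< fy<fx _ _ =
  ConvHull-witness> F beyond (subst (f x <_) (sym (affine-extension F δ x y)) (p<p+pos (0<*0< 0<δ (p<q⇒0<q-p fy<fx)))) ,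
  ConvHull-witness< F y∈P fy<fx
  where open RelIntExtension (RelInt-extend x∈relint y∈P)
... | tri> _ _ fx<fy =
  ConvHull-witness> F y∈P fx<fy ,
  ConvHull-witness< F beyond (subst (_< f x) (sym (affine-extension F δ x y)) (p+neg<p δ*[fx-fy]<0))
  where
  open RelIntExtension (RelInt-extend x∈relint y∈P)
  δ*[fx-fy]<0 : δ * (f x - f y) < 0ℚ
  δ*[fx-fy]<0 = subst (δ * (f x - f y) <_) (*-zeroʳ δ)
    (*-monoʳ-<-pos δ {{positive 0<δ}} (subst (f x - f y <_) (+-inverseʳ (f y)) (+-monoˡ-< (- f y) fx<fy)))

record CrossingParameter (A B b : ℚ) : Set where
  field
    α        : ℚ
    0<α      : 0ℚ < α
    α<1      : α < 1ℚ
    D*α≡b-B : (A - B) * α ≡ b - B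

crossing-parameter : ∀ {A B b} → B < b → b < A → CrossingParameter A B b
crossing-parameter {A} {B} {b} B<b b<A = record { α = α ; 0<α = 0<α ; α<1 = α<1 ; D*α≡b-B = D*α≡b-B }
  where
  D = A - B
  0<D : 0ℚ < D
  0<D = p<q⇒0<q-p (<-trans B<b b<A)
  instance
    D≢0 : NonZero D
    D≢0 = pos⇒nonZero D {{positive 0<D}}
  α = (b - B) * 1/ D
  D*α≡b-B : D * α ≡ b - B
  D*α≡b-B = begin
    D * ((b - B) * 1/ D) ≡⟨ solve 3 (λ D c e → D :* (c :* e) := c :* (e :* D)) refl D (b - B) (1/ D) ⟩
    (b - B) * (1/ D * D) ≡⟨ cong ((b - B) *_) (*-inverseˡ D) ⟩
    (b - B) * 1ℚ         ≡⟨ *-identityʳ (b - B) ⟩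
    b - B                ∎
    where open ≡-Reasoning
  0<α : 0ℚ < α
  0<α = 0<*0< (p<q⇒0<q-p B<b) (positive⁻¹ _ {{1/pos⇒pos D {{positive 0<D}}}})
  α<1 : α < 1ℚ
  α<1 = *-cancelˡ-<-nonNeg D {{nonNegative (<⇒≤ 0<D)}}
          (subst₂ _<_ (sym D*α≡b-B) (sym (*-identityʳ D)) (+-monoˡ-< (- B) b<A))

record ExposedSegment {d : ℕ} (Y : PSet d) (p q : Point d) : Set where
  field
    normal : Point d
    level  : ℚ
    p-on   : normal · p ≡ level
    q-on   : normal · q ≡ level
    below  : ∀ {z} → Y z → normal · z < level ⊎ z ≗ p ⊎ z ≗ q

  ≤level : ∀ {z} → Y z → normal · z ≤ level
  ≤level Yz with below Yz
  ... | inj₁ <level     = <⇒≤ <level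
  ... | inj₂ (inj₁ z≗p) = ≤-reflexive (trans (·-congˡ normal z≗p) p-on)
  ... | inj₂ (inj₂ z≗q) = ≤-reflexive (trans (·-congˡ normal z≗q) q-on)

  face-vanishing : ∀ {χ x} → IsAffine χ → χ p ≡ 0ℚ → χ q ≡ 0ℚ →
    ConvHull Y x → normal · x ≡ level → χ x ≡ 0ℚ
  face-vanishing X χp≡0 χq≡0 x∈Y x-on =
    ConvHull-face (difference-affine (const-affine level) (dot-affine normal)) X
      (λ Yz → p≤q⇒0≤q-p (≤level Yz)) on-face x∈Y (trans (cong (λ t → level - t) x-on) (+-inverseʳ level))
    where
    on-face : ∀ {z} → Y z → level - normal · z ≡ 0ℚ → _
    on-face Yz z-on with below Yz
    ... | inj₁ <level     = ⊥-elim (<-irrefl (q-p≡0⇒p≡q z-on) <level)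
    ... | inj₂ (inj₁ z≗p) = trans (resp-≗ X z≗p) χp≡0
    ... | inj₂ (inj₂ z≗q) = trans (resp-≗ X z≗q) χq≡0

module _ {d : ℕ} {Y : PSet d} where

  ExposedSegment-swap : ∀ {p q} → ExposedSegment Y p q → ExposedSegment Y q p
  ExposedSegment-swap E = record
    { normal = normal ; level = level ; p-on = q-on ; q-on = p-on
    ; below  = λ Yz → Data.Sum.map₂ Data.Sum.swap (below Yz)
    }
    where open ExposedSegment E

  ExposedSegment-resp : ∀ {p q p′ q′} → p ≗ p′ → q ≗ q′ →
    ExposedSegment Y p q → ExposedSegment Y p′ q′
  ExposedSegment-resp p≗p′ q≗q′ E = record
    { normal = normal ; level = level
    ; p-on   = trans (·-congˡ normal (λ k → sym (p≗p′ k))) p-on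
    ; q-on   = trans (·-congˡ normal (λ k → sym (q≗q′ k))) q-on
    ; below  = λ Yz → Data.Sum.map₂ (Data.Sum.map (λ z≗p k → trans (z≗p k) (p≗p′ k))
                                                  (λ z≗q k → trans (z≗q k) (q≗q′ k))) (below Yz)
    }
    where open ExposedSegment E

module _ {d : ℕ} {X : PSet d} (a : Point d) (b : ℚ) {V : List (Point d)}
         (V-integral : All IntegerPoint V)
         (upper-half : ∀ x → (ConvHull X x × b ≤ a · x) ⇔ ConvHull (_∈ V) x) where

  exposed-segment-does-not-cross : ∀ {Y p q r} → All (ConvHull Y) V → ExposedSegment Y p q →
    X p → X q → b < a · p → a · q < b → p r ≡ 1ℚ → q r ≡ 0ℚ → ⊥
  exposed-segment-does-not-cross {Y} {p} {q} {r} V⊆Y E Xp Xq b<a·p a·q<b p-r≡1 q-r≡0 =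
    integer∉⟨0,1⟩ n (subst (0ℚ <_) v-r≡n (subst (0ℚ <_) (sym v-r≡α) 0<α))
                    (subst (_< 1ℚ) v-r≡n (subst (_< 1ℚ) (sym v-r≡α) α<1))
    where
    open ExposedSegment E renaming (normal to w; level to M)
    open CrossingParameter (crossing-parameter a·q<b b<a·p)
    A = a · p
    B = a · q
    D = A - B
    y = lerp α p q

    y-on-H : a · y ≡ b
    y-on-H = begin
      a · y                 ≡⟨ affine-lerp (dot-affine a) α p q ⟩
      α * A + (1ℚ - α) * B  ≡⟨ solve 3 (λ α A B → α :* A :+ (con 1ℚ :- α) :* B := B :+ (A :- B) :* α) refl α A B ⟩
      B + D * α             ≡⟨ cong (λ t → B + t) D*α≡b-B ⟩
      B + (b - B)           ≡⟨ solve 2 (λ B b → B :+ (b :- B) := b) refl B b ⟩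
      b                     ∎
      where open ≡-Reasoning

    y-on-face : w · y ≡ M
    y-on-face = begin
      w · y                             ≡⟨ affine-lerp (dot-affine w) α p q ⟩
      α * (w · p) + (1ℚ - α) * (w · q)  ≡⟨ cong₂ (λ s t → α * s + (1ℚ - α) * t) p-on q-on ⟩
      α * M + (1ℚ - α) * M              ≡⟨ solve 2 (λ α M → α :* M :+ (con 1ℚ :- α) :* M := M) refl α M ⟩
      M                                 ∎
      where open ≡-Reasoning

    y∈conv-V : ConvHull (_∈ V) y
    y∈conv-V = Equivalence.to (upper-half y) (ConvHull-lerp Xp Xq (<⇒≤ 0<α) (<⇒≤ α<1) , ≤-reflexive (sym y-on-H))

    vertex = ConvHull-attains-bounds (dot-affine w) (dot-affine a)
      (λ v∈V → ConvHull-bounded (dot-affine w) ≤level (All.lookup V⊆Y v∈V))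
      (λ v∈V → proj₂ (Equivalence.from (upper-half _) (ConvHull-point v∈V)))
      y∈conv-V y-on-face y-on-H
    v = proj₁ vertex
    v∈V = proj₁ (proj₂ vertex)

    segment-equation : IsAffine (λ x → (a · x - B) - D * x r)
    segment-equation = difference-affine (difference-affine (dot-affine a) (const-affine B)) (scale-affine D (coordinate-affine r))

    v-on-segment : (a · v - B) - D * v r ≡ 0ℚ
    v-on-segment = face-vanishing segment-equation
      (trans (cong (λ t → (A - B) - D * t) p-r≡1) (solve 2 (λ A B → (A :- B) :- (A :- B) :* con 1ℚ := con 0ℚ) refl A B))
      (trans (cong (λ t → (B - B) - D * t) q-r≡0) (solve 2 (λ A B → (B :- B) :- (A :- B) :* con 0ℚ := con 0ℚ) refl A B))
      (All.lookup V⊆Y v∈V) (proj₁ (proj₂ (proj₂ vertex)))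

    v-r≡α : v r ≡ α
    v-r≡α = *-cancelˡ-≡-pos (p<q⇒0<q-p (<-trans a·q<b b<a·p))
      (trans (q-p≡0⇒p≡q (subst (λ t → (t - B) - D * v r ≡ 0ℚ) (proj₂ (proj₂ (proj₂ vertex))) v-on-segment))
             (sym D*α≡b-B))

    n = proj₁ (All.lookup V-integral v∈V r)
    v-r≡n = proj₂ (All.lookup V-integral v∈V r)

module _ {d : ℕ} {K : Set} (g : K → Point d) where

  Image : PSet d
  Image x = Σ K λ k → x ≡ g k

  ImageOf : List K → PSet d
  ImageOf ks x = Σ K λ k → k ∈ ks × x ≡ g k

  ConvHull-finite-support : ∀ {V} → All (ConvHull Image) V → Σ (List K) λ ks → All (ConvHull (ImageOf ks)) V
  ConvHull-finite-support [] = [] , []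
  ConvHull-finite-support ((L , members , sum≡1 , x≗L) ∷ rest)
    with support members | ConvHull-finite-support rest
    where
    support : ∀ {L} → All (λ wp → 0ℚ ≤ proj₁ wp × Image (proj₂ wp)) L →
              Σ (List K) λ ks → All (λ wp → 0ℚ ≤ proj₁ wp × ImageOf ks (proj₂ wp)) L
    support []                    = [] , []
    support ((0≤μ , k , z≡gk) ∷ h) with support h
    ... | ks , h′ =
      k ∷ ks , (0≤μ , k , here refl , z≡gk) ∷ All.map (λ (0≤ν , k′ , k′∈ks , e) → 0≤ν , k′ , there k′∈ks , e) h′
  ... | ks , members′ | ks′ , rest′ =
    ks ++ ks′ ,
    ConvHull-mono (λ (k , k∈ks , e) → k , ∈-++⁺ˡ k∈ks , e) (L , members′ , sum≡1 , x≗L) ∷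
    All.map (ConvHull-mono (λ (k , k∈ks′ , e) → k , ∈-++⁺ʳ ks k∈ks′ , e)) rest′

SamePair : ∀ {d} → Fin d → Fin d → Fin d → Fin d → Set
SamePair i j p q = (p ≡ i × q ≡ j) ⊎ (p ≡ j × q ≡ i)

samePair? : ∀ {d} (i j p q : Fin d) → Dec (SamePair i j p q)
samePair? i j p q = ((p ≟ i) ×-dec (q ≟ j)) ⊎-dec ((p ≟ j) ×-dec (q ≟ i))

SamePair-swap : ∀ {d} {i j p q : Fin d} → SamePair i j p q → SamePair j i p q
SamePair-swap = Data.Sum.swap

SamePair-ρ : ∀ {d} {i j p q : Fin d} → SamePair i j p q → ρ p q ≗ ρ i j
SamePair-ρ (inj₁ (refl , refl)) k = refl
SamePair-ρ (inj₂ (refl , refl)) k = ρ-comm _ _ k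

module _ {d : ℕ} (G : SimpleGraph d) where

  Edge : Set
  Edge = Σ (Fin d) λ i → Σ (Fin d) λ j → Adj G i j

  edgePoint : Edge → Point d
  edgePoint (i , j , _) = ρ i j

  EdgePolytope⊆ConvHull-Image : ∀ {x} → EdgePolytope G x → ConvHull (Image edgePoint) x
  EdgePolytope⊆ConvHull-Image = ConvHull-mono (λ (i , j , ij , x≡ρij) → (i , j , ij) , x≡ρij)

  SamePair-Adj : ∀ {i j p q} → SamePair i j p q → Adj G p q → Adj G i j
  SamePair-Adj (inj₁ (refl , refl)) pq = pq
  SamePair-Adj (inj₂ (refl , refl)) pq = symm G pq

  ≢-Adj : ∀ {i j} → Adj G i j → i ≢ j
  ≢-Adj ij refl = irrefl G ij

  exposed-by-weights : ∀ {i j k l} (F : List Edge) (w : Point d) (M : ℚ) → w i + w j ≡ M → w k + w l ≡ M →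
    (∀ {p q} (pq : Adj G p q) → (p , q , pq) ∈ F → w p + w q < M ⊎ SamePair i j p q ⊎ SamePair k l p q) →
    ExposedSegment (ImageOf edgePoint F) (ρ i j) (ρ k l)
  exposed-by-weights {i} {j} {k} {l} F w M ij-on kl-on good = record
    { normal = w ; level = M
    ; p-on   = trans (·-ρ w i j) ij-on
    ; q-on   = trans (·-ρ w k l) kl-on
    ; below  = below
    }
    where
    below : ∀ {z} → ImageOf edgePoint F z → w · z < M ⊎ z ≗ ρ i j ⊎ z ≗ ρ k l
    below ((p , q , pq) , pq∈F , refl) with good pq pq∈F
    ... | inj₁ w<M            = inj₁ (subst (_< M) (sym (·-ρ w p q)) w<M)
    ... | inj₂ (inj₁ same-ij) = inj₂ (inj₁ (SamePair-ρ same-ij))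
    ... | inj₂ (inj₂ same-kl) = inj₂ (inj₂ (SamePair-ρ same-kl))

separating-coordinate : ∀ {d} {i j k l : Fin d} → i ≢ j → ¬ SamePair i j k l →
  Σ (Fin d) λ r → ρ i j r ≡ 1ℚ × ρ k l r ≡ 0ℚ
separating-coordinate {i = i} {j} {k} {l} i≢j ¬same with i ≟ k | i ≟ l | j ≟ k | j ≟ l
... | no i≢k   | no i≢l   | _        | _        = i , ρ-at-first , ρ-outside i≢k i≢l
  where
  ρ-at-first : ρ i j i ≡ 1ℚ
  ρ-at-first rewrite unit-self i | unit-≢ {i = j} i≢j = refl
... | _        | _        | no j≢k   | no j≢l   = j , ρ-at-second , ρ-outside j≢k j≢l
  where
  ρ-at-second : ρ i j j ≡ 1ℚ
  ρ-at-second rewrite unit-≢ {i = i} (λ j≡i → i≢j (sym j≡i)) | unit-self j = refl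
... | yes refl | _        | yes refl | _        = ⊥-elim (i≢j refl)
... | yes refl | _        | _        | yes refl = ⊥-elim (¬same (inj₁ (refl , refl)))
... | _        | yes refl | yes refl | _        = ⊥-elim (¬same (inj₂ (refl , refl)))
... | _        | yes refl | _        | yes refl = ⊥-elim (i≢j refl)

module SharedEndpoint {d : ℕ} (G : SimpleGraph d) (s x z : Fin d) where

  data Role : Set where
    centre left right other : Role

  data RoleOf (p : Fin d) : Role → Set where
    at-centre : p ≡ s → RoleOf p centre
    at-left   : p ≡ x → RoleOf p left
    at-right  : p ≡ z → RoleOf p right
    elsewhere : RoleOf p other

  role : Fin d → Role
  role p with p ≟ s | p ≟ x | p ≟ z
  ... | yes _ | _     | _     = centre
  ... | no _  | yes _ | _     = left
  ... | no _  | no _  | yes _ = right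
  ... | no _  | no _  | no _  = other

  roleOf : ∀ p → RoleOf p (role p)
  roleOf p with p ≟ s | p ≟ x | p ≟ z
  ... | yes p≡s | _       | _       = at-centre p≡s
  ... | no _    | yes p≡x | _       = at-left p≡x
  ... | no _    | no _    | yes p≡z = at-right p≡z
  ... | no _    | no _    | no _    = elsewhere

  -- Only the pairs sx and sz reach 3.
  value : Role → ℚ
  value centre = ℤ.+ 2 / 1
  value left   = 1ℚ
  value right  = 1ℚ
  value other  = 0ℚ

  weight : Point d
  weight p = value (role p)

  module _ (sx : Adj G s x) (sz : Adj G s z) (x≢z : x ≢ z) where

    x≢s : x ≢ s
    x≢s x≡s = ≢-Adj G sx (sym x≡s)

    role-s : role s ≡ centre
    role-s with s ≟ s | s ≟ x | s ≟ z
    ... | yes _  | _ | _ = refl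
    ... | no s≢s | _ | _ = ⊥-elim (s≢s refl)

    role-x : role x ≡ left
    role-x with x ≟ s | x ≟ x | x ≟ z
    ... | yes x≡s | _      | _ = ⊥-elim (x≢s x≡s)
    ... | no _    | yes _  | _ = refl
    ... | no _    | no x≢x | _ = ⊥-elim (x≢x refl)

    role-z : role z ≡ right
    role-z with z ≟ s | z ≟ x | z ≟ z
    ... | yes z≡s | _       | _      = ⊥-elim (≢-Adj G sz (sym z≡s))
    ... | no _    | yes z≡x | _      = ⊥-elim (x≢z (sym z≡x))
    ... | no _    | no _    | yes _  = refl
    ... | no _    | no _    | no z≢z = ⊥-elim (z≢z refl)

    below-3 : ∀ {p q} (r t : Role) → RoleOf p r → RoleOf q t → Adj G p q →
      value r + value t < ℤ.+ 3 / 1 ⊎ SamePair s x p q ⊎ SamePair s z p q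
    below-3 centre centre (at-centre refl) (at-centre refl) pq = ⊥-elim (irrefl G pq)
    below-3 centre left   (at-centre refl) (at-left refl)   _  = inj₂ (inj₁ (inj₁ (refl , refl)))
    below-3 left   centre (at-left refl)   (at-centre refl) _  = inj₂ (inj₁ (inj₂ (refl , refl)))
    below-3 centre right  (at-centre refl) (at-right refl)  _  = inj₂ (inj₂ (inj₁ (refl , refl)))
    below-3 right  centre (at-right refl)  (at-centre refl) _  = inj₂ (inj₂ (inj₂ (refl , refl)))
    below-3 centre other  _ _ _ = inj₁ decide-<
    below-3 left   left   _ _ _ = inj₁ decide-<
    below-3 left   right  _ _ _ = inj₁ decide-<
    below-3 left   other  _ _ _ = inj₁ decide-<
    below-3 right  left   _ _ _ = inj₁ decide-<
    below-3 right  right  _ _ _ = inj₁ decide-<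
    below-3 right  other  _ _ _ = inj₁ decide-<
    below-3 other  centre _ _ _ = inj₁ decide-<
    below-3 other  left   _ _ _ = inj₁ decide-<
    below-3 other  right  _ _ _ = inj₁ decide-<
    below-3 other  other  _ _ _ = inj₁ decide-<

    shared-endpoint-exposed : ∀ F → ExposedSegment (ImageOf (edgePoint G) F) (ρ s x) (ρ s z)
    shared-endpoint-exposed F = exposed-by-weights G F weight (ℤ.+ 3 / 1)
      (cong₂ (λ r t → value r + value t) role-s role-x)
      (cong₂ (λ r t → value r + value t) role-s role-z)
      (λ {p} {q} pq _ → below-3 (role p) (role q) (roleOf p) (roleOf q) pq)

module DisjointEdges {d : ℕ} (G : SimpleGraph d) (c c′ u v : Fin d) where

  data Role : Set where
    centre partner first second other : Role

  data RoleOf (p : Fin d) : Role → Set where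
    at-centre  : p ≡ c  → RoleOf p centre
    at-partner : p ≡ c′ → RoleOf p partner
    at-first   : p ≡ u  → RoleOf p first
    at-second  : p ≡ v  → RoleOf p second
    elsewhere  : RoleOf p other

  role : Fin d → Role
  role p with p ≟ c | p ≟ c′ | p ≟ u | p ≟ v
  ... | yes _ | _     | _     | _     = centre
  ... | no _  | yes _ | _     | _     = partner
  ... | no _  | no _  | yes _ | _     = first
  ... | no _  | no _  | no _  | yes _ = second
  ... | no _  | no _  | no _  | no _  = other

  roleOf : ∀ p → RoleOf p (role p)
  roleOf p with p ≟ c | p ≟ c′ | p ≟ u | p ≟ v
  ... | yes p≡c | _        | _       | _       = at-centre p≡c
  ... | no _    | yes p≡c′ | _       | _       = at-partner p≡c′
  ... | no _    | no _     | yes p≡u | _       = at-first p≡u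
  ... | no _    | no _     | no _    | yes p≡v = at-second p≡v
  ... | no _    | no _     | no _    | no _    = elsewhere

  -- The pairs cc′ and uv sum to 8, the pairs cu and cv (assumed absent) to 9 and
  -- every other pair to less than 8.
  value : Role → ℚ
  value centre  = ℤ.+ 5 / 1
  value partner = ℤ.+ 3 / 1
  value first   = ℤ.+ 4 / 1
  value second  = ℤ.+ 4 / 1
  value other   = 0ℚ

  weight : Point d
  weight p = value (role p)

  module _ (cc′ : Adj G c c′) (uv : Adj G u v)
           (u≢c : u ≢ c) (u≢c′ : u ≢ c′) (v≢c : v ≢ c) (v≢c′ : v ≢ c′) where

    role-c : role c ≡ centre
    role-c with c ≟ c | c ≟ c′ | c ≟ u | c ≟ v
    ... | yes _  | _ | _ | _ = refl
    ... | no c≢c | _ | _ | _ = ⊥-elim (c≢c refl)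

    role-c′ : role c′ ≡ partner
    role-c′ with c′ ≟ c | c′ ≟ c′ | c′ ≟ u | c′ ≟ v
    ... | yes c′≡c | _        | _ | _ = ⊥-elim (≢-Adj G cc′ (sym c′≡c))
    ... | no _     | yes _    | _ | _ = refl
    ... | no _     | no c′≢c′ | _ | _ = ⊥-elim (c′≢c′ refl)

    role-u : role u ≡ first
    role-u with u ≟ c | u ≟ c′ | u ≟ u | u ≟ v
    ... | yes u≡c | _        | _      | _ = ⊥-elim (u≢c u≡c)
    ... | no _    | yes u≡c′ | _      | _ = ⊥-elim (u≢c′ u≡c′)
    ... | no _    | no _     | yes _  | _ = refl
    ... | no _    | no _     | no u≢u | _ = ⊥-elim (u≢u refl)

    role-v : role v ≡ second
    role-v with v ≟ c | v ≟ c′ | v ≟ u | v ≟ v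
    ... | yes v≡c | _        | _       | _      = ⊥-elim (v≢c v≡c)
    ... | no _    | yes v≡c′ | _       | _      = ⊥-elim (v≢c′ v≡c′)
    ... | no _    | no _     | yes v≡u | _      = ⊥-elim (≢-Adj G uv (sym v≡u))
    ... | no _    | no _     | no _    | yes _  = refl
    ... | no _    | no _     | no _    | no v≢v = ⊥-elim (v≢v refl)

    below-8 : ∀ {p q} (r t : Role) → RoleOf p r → RoleOf q t → Adj G p q → ¬ SamePair c u p q → ¬ SamePair c v p q →
      value r + value t < ℤ.+ 8 / 1 ⊎ SamePair c c′ p q ⊎ SamePair u v p q
    below-8 centre  centre  (at-centre refl)  (at-centre refl)  pq _ _ = ⊥-elim (irrefl G pq)
    below-8 centre  partner (at-centre refl)  (at-partner refl) _ _ _  = inj₂ (inj₁ (inj₁ (refl , refl)))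
    below-8 centre  first   (at-centre refl)  (at-first refl)   _ ¬cu _ = ⊥-elim (¬cu (inj₁ (refl , refl)))
    below-8 centre  second  (at-centre refl)  (at-second refl)  _ _ ¬cv = ⊥-elim (¬cv (inj₁ (refl , refl)))
    below-8 centre  other   _ _ _ _ _ = inj₁ decide-<
    below-8 partner centre  (at-partner refl) (at-centre refl)  _ _ _  = inj₂ (inj₁ (inj₂ (refl , refl)))
    below-8 partner partner (at-partner refl) (at-partner refl) pq _ _ = ⊥-elim (irrefl G pq)
    below-8 partner first   _ _ _ _ _ = inj₁ decide-<
    below-8 partner second  _ _ _ _ _ = inj₁ decide-<
    below-8 partner other   _ _ _ _ _ = inj₁ decide-<
    below-8 first   centre  (at-first refl)   (at-centre refl)  _ ¬cu _ = ⊥-elim (¬cu (inj₂ (refl , refl)))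
    below-8 first   partner _ _ _ _ _ = inj₁ decide-<
    below-8 first   first   (at-first refl)   (at-first refl)   pq _ _ = ⊥-elim (irrefl G pq)
    below-8 first   second  (at-first refl)   (at-second refl)  _ _ _  = inj₂ (inj₂ (inj₁ (refl , refl)))
    below-8 first   other   _ _ _ _ _ = inj₁ decide-<
    below-8 second  centre  (at-second refl)  (at-centre refl)  _ _ ¬cv = ⊥-elim (¬cv (inj₂ (refl , refl)))
    below-8 second  partner _ _ _ _ _ = inj₁ decide-<
    below-8 second  first   (at-second refl)  (at-first refl)   _ _ _  = inj₂ (inj₂ (inj₂ (refl , refl)))
    below-8 second  second  (at-second refl)  (at-second refl)  pq _ _ = ⊥-elim (irrefl G pq)
    below-8 second  other   _ _ _ _ _ = inj₁ decide-<
    below-8 other   centre  _ _ _ _ _ = inj₁ decide-<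
    below-8 other   partner _ _ _ _ _ = inj₁ decide-<
    below-8 other   first   _ _ _ _ _ = inj₁ decide-<
    below-8 other   second  _ _ _ _ _ = inj₁ decide-<
    below-8 other   other   _ _ _ _ _ = inj₁ decide-<

    disjoint-exposed : ∀ F → (∀ {p q} (pq : Adj G p q) → (p , q , pq) ∈ F → ¬ SamePair c u p q × ¬ SamePair c v p q) →
      ExposedSegment (ImageOf (edgePoint G) F) (ρ c c′) (ρ u v)
    disjoint-exposed F missing = exposed-by-weights G F weight (ℤ.+ 8 / 1)
      (cong₂ (λ r t → value r + value t) role-c role-c′)
      (cong₂ (λ r t → value r + value t) role-u role-v)
      (λ {p} {q} pq pq∈F → let (¬cu , ¬cv) = missing pq pq∈F in below-8 (role p) (role q) (roleOf p) (roleOf q) pq ¬cu ¬cv)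

module _ {d : ℕ} (G : SimpleGraph d) (F : List (Edge G)) where

  -- Adjacency in G is not decidable: whether a pair is an edge is only decided among
  -- the finitely many edges F that represent the vertices of the upper half.
  Linked : Fin d → Fin d → Set
  Linked i k = Any (λ e → SamePair i k (proj₁ e) (proj₁ (proj₂ e))) F

  linked? : ∀ i k → Dec (Linked i k)
  linked? i k = any? (λ e → samePair? i k (proj₁ e) (proj₁ (proj₂ e))) F

  Linked⇒Adj : ∀ {i k} → Linked i k → Adj G i k
  Linked⇒Adj linked = let ((_ , _ , pq) , same) = Data.List.Relation.Unary.Any.satisfied linked in SamePair-Adj G same pq

  unlinked : ∀ {i k} → ¬ Linked i k → ∀ {p q} (pq : Adj G p q) → (p , q , pq) ∈ F → ¬ SamePair i k p q
  unlinked ¬linked pq pq∈F same = ¬linked (lose pq∈F same)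

  unlinked-swap : ∀ {i k} → ¬ Linked i k → ∀ {p q} (pq : Adj G p q) → (p , q , pq) ∈ F → ¬ SamePair k i p q
  unlinked-swap ¬linked pq pq∈F same = unlinked ¬linked pq pq∈F (SamePair-swap same)

  Cycle4OrExposed : Fin d → Fin d → Fin d → Fin d → Set
  Cycle4OrExposed i j k l = HasCycle4 G ⊎ ExposedSegment (ImageOf (edgePoint G) F) (ρ i j) (ρ k l)

  disjoint-edges-cycle4-or-exposed : ∀ {i j k l} → Adj G i j → Adj G k l →
    i ≢ k → i ≢ l → j ≢ k → j ≢ l → Cycle4OrExposed i j k l
  disjoint-edges-cycle4-or-exposed {i} {j} {k} {l} ij kl i≢k i≢l j≢k j≢l =
    by-links (linked? i k) (linked? j l) (linked? i l) (linked? j k)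
    where
    exposed = λ c c′ u v → DisjointEdges.disjoint-exposed G c c′ u v

    by-links : Dec (Linked i k) → Dec (Linked j l) → Dec (Linked i l) → Dec (Linked j k) → Cycle4OrExposed i j k l
    by-links (yes ik) (yes jl) _ _ = inj₁
      (i , k , l , j , i≢k , i≢l , ≢-Adj G ij , ≢-Adj G kl , ≢-sym j≢k , ≢-sym j≢l ,
       Linked⇒Adj ik , kl , symm G (Linked⇒Adj jl) , symm G ij)
    by-links _ _ (yes il) (yes jk) = inj₁
      (i , l , k , j , i≢l , i≢k , ≢-Adj G ij , ≢-sym (≢-Adj G kl) , ≢-sym j≢l , ≢-sym j≢k ,
       Linked⇒Adj il , symm G kl , symm G (Linked⇒Adj jk) , symm G ij)
    by-links (no ¬ik) _ (no ¬il) _ = inj₂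
      (exposed i j k l ij kl (≢-sym i≢k) (≢-sym j≢k) (≢-sym i≢l) (≢-sym j≢l) F
        λ pq pq∈F → unlinked ¬ik pq pq∈F , unlinked ¬il pq pq∈F)
    by-links (no ¬ik) _ _ (no ¬jk) = inj₂ (ExposedSegment-swap
      (exposed k l i j kl ij i≢k i≢l j≢k j≢l F
        λ pq pq∈F → unlinked-swap ¬ik pq pq∈F , unlinked-swap ¬jk pq pq∈F))
    by-links _ (no ¬jl) (no ¬il) _ = inj₂ (ExposedSegment-resp (λ _ → refl) (ρ-comm l k) (ExposedSegment-swap
      (exposed l k i j (symm G kl) ij i≢l i≢k j≢l j≢k F
        λ pq pq∈F → unlinked-swap ¬il pq pq∈F , unlinked-swap ¬jl pq pq∈F)))
    by-links _ (no ¬jl) _ (no ¬jk) = inj₂ (ExposedSegment-resp (ρ-comm j i) (λ _ → refl)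
      (exposed j i k l (symm G ij) kl (≢-sym j≢k) (≢-sym i≢k) (≢-sym j≢l) (≢-sym i≢l) F
        λ pq pq∈F → unlinked ¬jk pq pq∈F , unlinked ¬jl pq pq∈F))

  cycle4-or-exposed : ∀ {i j k l} → Adj G i j → Adj G k l → ¬ SamePair i j k l → Cycle4OrExposed i j k l
  cycle4-or-exposed {i} {j} {k} {l} ij kl ¬same = by-cases ij kl ¬same (i ≟ k) (i ≟ l) (j ≟ k) (j ≟ l)
    where
    shared : ∀ {s x z} → Adj G s x → Adj G s z → x ≢ z → ExposedSegment (ImageOf (edgePoint G) F) (ρ s x) (ρ s z)
    shared {s} {x} {z} sx sz x≢z = SharedEndpoint.shared-endpoint-exposed G s x z sx sz x≢z F

    by-cases : ∀ {i j k l} → Adj G i j → Adj G k l → ¬ SamePair i j k l →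
      Dec (i ≡ k) → Dec (i ≡ l) → Dec (j ≡ k) → Dec (j ≡ l) → Cycle4OrExposed i j k l
    by-cases ij kl ¬same (yes refl) _ _ _ =
      inj₂ (shared ij kl λ { refl → ¬same (inj₁ (refl , refl)) })
    by-cases {i} {j} {k} ij kl ¬same (no _) (yes refl) _ _ =
      inj₂ (ExposedSegment-resp (λ _ → refl) (ρ-comm i k) (shared ij (symm G kl) λ { refl → ¬same (inj₂ (refl , refl)) }))
    by-cases {i} {j} ij kl ¬same (no _) (no i≢l) (yes refl) _ =
      inj₂ (ExposedSegment-resp (ρ-comm j i) (λ _ → refl) (shared (symm G ij) kl i≢l))
    by-cases {i} {j} {k} ij kl ¬same (no i≢k) (no _) (no _) (yes refl) =
      inj₂ (ExposedSegment-resp (ρ-comm j i) (ρ-comm j k) (shared (symm G ij) (symm G kl) i≢k))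
    by-cases ij kl ¬same (no i≢k) (no i≢l) (no j≢k) (no j≢l) =
      disjoint-edges-cycle4-or-exposed ij kl i≢k i≢l j≢k j≢l

straddling-edges-differ : ∀ {d} {a : Point d} {b i j k l} → b < a · ρ i j → a · ρ k l < b → ¬ SamePair i j k l
straddling-edges-differ {a = a} above below same = <-irrefl (·-congˡ a (SamePair-ρ same)) (<-trans below above)

module _ {d : ℕ} (G : SimpleGraph d) (a : Point d) (b : ℚ) {V : List (Point d)}
         (V-integral : All IntegerPoint V)
         (upper-half : ∀ x → (EdgePolytope G x × b ≤ a · x) ⇔ ConvHull (_∈ V) x) where

  straddling-edges⇒cycle4 : ∀ {i j k l} → Adj G i j → Adj G k l → b < a · ρ i j → a · ρ k l < b → HasCycle4 G
  straddling-edges⇒cycle4 {i} {j} {k} {l} ij kl above below =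
    [ id , (λ exposed → ⊥-elim (does-not-cross exposed)) ] (cycle4-or-exposed G F ij kl differ)
    where
    differ = straddling-edges-differ {a = a} above below
    support = ConvHull-finite-support (edgePoint G) (All.tabulate λ v∈V →
                EdgePolytope⊆ConvHull-Image G (proj₁ (Equivalence.from (upper-half _) (ConvHull-point v∈V))))
    F = proj₁ support
    separation = separating-coordinate (≢-Adj G ij) differ

    does-not-cross : ExposedSegment (ImageOf (edgePoint G) F) (ρ i j) (ρ k l) → ⊥
    does-not-cross exposed = exposed-segment-does-not-cross a b V-integral upper-half {r = proj₁ separation}
      (proj₂ support) exposed (i , j , ij , refl) (k , l , kl , refl) above below
      (proj₁ (proj₂ separation)) (proj₂ (proj₂ separation))

corollary1p6 : (d : ℕ) (G : SimpleGraph d) → Connected G →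
    Decomposable (EdgePolytope G) → HasCycle4 G
corollary1p6 d G _ (a , b , _ , (x₀ , x₀∈relint , on-H) , (x₁ , x₁∈P , off-H) , (V , V-integral , upper-half) , _)
  with hyperplane-through-RelInt-splits (dot-affine a) x₀∈relint on-H x₁∈P off-H
... | (_ , (i , j , ij , refl) , above) , (_ , (k , l , kl , refl) , below) =
  straddling-edges⇒cycle4 G a b V-integral upper-half ij kl above below
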